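{- Let $\lambda=(m,n)$ be a triangular $2$-partition and $\theta$ a row-regular tableau on $\lambda$. Then for each $d$ with $0\le d\le\min(n,m-n)$ and each $a$ with $d\le a\le m+n-2d$, there is a unique subpartition $\mu\subseteq\lambda$ with $\mathrm{def}_\theta(\mu)=d$ and $\mathrm{area}(\lambda,\mu)=a$; moreover every subpartition of $\lambda$ arises in this way for such a pair $(d,a)$.
   Context: Partitions are drawn in French convention: cell $(\ell,c)$ ($\ell\ge0$ row from bottom, $c\ge0$ column) belongs to $\lambda$ iff $c<\lambda_{\ell+1}$. A $2$-partition $(m,n)$ has $m\ge n\ge0$. A partition is triangular if there exist positive reals $r,s$ with $\lambda_j=\lfloor r-jr/s\rfloor$ for $1\le j\le s$ and $\lambda_j=0$ for $j>s$. Subpartitions $\mu\subseteq\lambda$ satisfy $\mu_i\le\lambda_i$; $\mathrm{area}(\lambda,\mu)=|\lambda|-|\mu|$. For a standard Young tableau $\theta$ of shape $\lambda$, a cell $d$ is a $\theta$-deficit cell of $(\lambda,\mu)$ if there exist cells $c_1=(i_1,j_1)\in\mu$, $c_2=(i_2,j_2)\in\lambda\setminus\mu$ with $\theta(c_1)>\theta(c_2)$ and $d=(\min(i_1,i_2),\min(j_1,j_2))$; $\mathrm{def}_\theta(\mu)$ is the number of $\theta$-deficit cells. For $1\le i\le m-2(n-1)$, the $i$-row-regular tableau of $(m,n)$ is the standard Young tableau with upper-row labels $n+i,n+i+2,\dots,n+i+2(n-1)$; a row-regular tableau is one of these.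
   Formalization: In the triangularity hypothesis on λ, the numbers r and s are taken to be positive rationals rather than positive reals. -}

module Defs where

open import Data.Nat using (ℕ; zero; suc; _+_; _*_; _∸_; _≤_; _<_; _⊓_)
open import Data.Integer using (ℤ; +_)
open import Data.Rational using (ℚ; _/_; floor; _-_; _÷_; Positive)
  renaming (_*_ to _*ℚ_; _≤_ to _≤ℚ_; _<_ to _<ℚ_)
open import Data.Rational.Properties using (pos⇒nonZero)
open import Data.Product using (Σ; _×_; _,_; proj₁; proj₂)
open import Data.Empty using (⊥)
open import Data.List using (List; length)
open import Data.List.Membership.Propositional using (_∈_)
open import Data.List.Relation.Unary.Unique.Propositional using (Unique)
open import Relation.Binary.PropositionalEquality using (_≡_)
open import Function.Bundles using (_⇔_)

-- The 2-partition λ = (m , n)   (m ≥ n ≥ 0 is imposed separately)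

-- parts, 1-indexed:  λ_1 = m, λ_2 = n, λ_j = 0 for j ≥ 3  (λ_0 unused)
part : ℕ → ℕ → ℕ → ℕ
part m n 1 = m
part m n 2 = n
part m n _ = 0

-- rows, 0-indexed (French convention): row ℓ has length λ_{ℓ+1}
rowLen : ℕ → ℕ → ℕ → ℕ
rowLen m n ℓ = part m n (suc ℓ)

-- cells are pairs (ℓ , c) = (row from bottom, column)
Cell : Set
Cell = ℕ × ℕ

_∈ₚ_ : Cell → ℕ × ℕ → Set
(ℓ , c) ∈ₚ (m , n) = c < rowLen m n ℓ

ℕ→ℚ : ℕ → ℚ
ℕ→ℚ j = (+ j) / 1

Triangular : ℕ → ℕ → Set
Triangular m n =
  Σ ℚ λ r → Σ ℚ λ s → Σ (Positive r) λ _ → Σ (Positive s) λ sp →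
    (∀ j → 1 ≤ j → ℕ→ℚ j ≤ℚ s →
       + part m n j ≡ floor (r - _÷_ (ℕ→ℚ j *ℚ r) s {{pos⇒nonZero s {{sp}}}}))
    × (∀ j → s <ℚ ℕ→ℚ j → part m n j ≡ 0)

-- Standard Young tableaux of shape (m , n):  θ : row → column → label

SYT : ℕ → ℕ → (ℕ → ℕ → ℕ) → Set
SYT m n θ =
  (∀ ℓ c → (ℓ , c) ∈ₚ (m , n) → 1 ≤ θ ℓ c × θ ℓ c ≤ m + n)
  × (∀ ℓ c ℓ' c' → (ℓ , c) ∈ₚ (m , n) → (ℓ' , c') ∈ₚ (m , n) →
       θ ℓ c ≡ θ ℓ' c' → (ℓ , c) ≡ (ℓ' , c'))
  × (∀ k → 1 ≤ k → k ≤ m + n → Σ Cell λ x → x ∈ₚ (m , n) × θ (proj₁ x) (proj₂ x) ≡ k)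
  × (∀ ℓ c → (ℓ , suc c) ∈ₚ (m , n) → θ ℓ c < θ ℓ (suc c))
  × (∀ ℓ c → (suc ℓ , c) ∈ₚ (m , n) → θ ℓ c < θ (suc ℓ) c)

IsRowRegular : ℕ → ℕ → ℕ → (ℕ → ℕ → ℕ) → Set
IsRowRegular m n i θ =
  SYT m n θ × (∀ c → c < n → θ 1 c ≡ n + i + 2 * c)

RowRegular : ℕ → ℕ → (ℕ → ℕ → ℕ) → Set
RowRegular m n θ =
  Σ ℕ λ i → 1 ≤ i × (i + 2 * n ≤ m + 2) × IsRowRegular m n i θ

-- Subpartitions μ = (p , q) ⊆ λ = (m , n)  (μ has at most 2 parts since μ_j ≤ λ_j)

Subpartition : ℕ × ℕ → ℕ × ℕ → Set
Subpartition (p , q) (m , n) = q ≤ p × p ≤ m × q ≤ n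

area : ℕ × ℕ → ℕ × ℕ → ℕ
area (m , n) (p , q) = (m + n) ∸ (p + q)

min : ℕ → ℕ → ℕ
min = _⊓_

IsDeficitCell : ℕ × ℕ → (ℕ → ℕ → ℕ) → ℕ × ℕ → Cell → Set
IsDeficitCell lam θ mu d =
  Σ Cell λ c₁ → Σ Cell λ c₂ →
    let (i₁ , j₁) = c₁ ; (i₂ , j₂) = c₂ in
    c₁ ∈ₚ mu × c₂ ∈ₚ lam × (c₂ ∈ₚ mu → ⊥)
    × θ i₂ j₂ < θ i₁ j₁
    × d ≡ (min i₁ i₂ , min j₁ j₂)

HasDef : ℕ × ℕ → (ℕ → ℕ → ℕ) → ℕ × ℕ → ℕ → Set
HasDef lam θ mu d =
  Σ (List Cell) λ xs → Unique xs × (∀ x → (x ∈ xs) ⇔ IsDeficitCell lam θ mu x)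
    × length xs ≡ d

{-# OPTIONS --safe #-}

-- Write the upper-row labels of the i-row-regular tableau as 2 + k + 2c, where k = n + i - 2.
-- The bottom row takes the remaining labels in increasing order, so its label in column j is
-- j + 1 + upperBelow j, where upperBelow j = min n (j - k) counts the upper labels below it.
-- Comparing labels, the θ-deficit cells of μ = (p , q) are the bottom cells in the columns
-- [min q (upperBelow p) , max q (upperBelow (p - 1))), so def μ is the length of that interval.
-- A case split on p against k and k + n shows that μ ↦ (def μ , |μ|) has an explicit left
-- inverse on subpartitions and that its image is {(d , s) : d ≤ min n (m - n), 2d ≤ s,
-- s + d ≤ m + n}; with a = m + n - s these are the bounds of the statement.

module Submission where

open import Defs
open import Data.Nat using (ℕ; _+_; _*_; _∸_; _≤_)
open import Data.Product using (Σ; _×_; _,_)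
open import Relation.Binary.PropositionalEquality using (_≡_)

open import Data.Nat using (zero; suc; pred; _<_; _≮_; _≰_; _≤?_; _<?_; _⊓_; _⊔_; z≤n; s≤s)
open import Data.Nat.Properties
open import Data.Nat.Tactic.RingSolver using (solve)
open import Data.Product using (∃; proj₁; proj₂; map; map₁)
open import Data.Sum using (inj₁; inj₂)
open import Data.List using (List; []; _∷_; length; applyUpTo)
open import Data.List.Properties using (length-applyUpTo)
open import Data.List.Membership.Propositional using (_∈_)
open import Data.List.Membership.Propositional.Properties using (∈-applyUpTo⁺; ∈-applyUpTo⁻)
open import Data.List.Membership.Propositional.Properties.WithK using (unique∧set⇒bag)
open import Data.List.Relation.Binary.BagAndSetEquality using (∼bag⇒↭)
open import Data.List.Relation.Binary.Permutation.Propositional.Properties using (↭-length)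
open import Data.List.Relation.Unary.Unique.Propositional using (Unique)
open import Data.List.Relation.Unary.Unique.Propositional.Properties using (applyUpTo⁺₁)
open import Function using (_∘_)
open import Function.Bundles using (_⇔_; mk⇔)
import Function.Properties.Equivalence as ⇔
open import Relation.Binary.Definitions using (tri<; tri≈; tri>)
open import Relation.Binary.PropositionalEquality
  using (_≢_; refl; sym; trans; cong; cong₂; subst; subst₂; module ≡-Reasoning)
open import Relation.Nullary using (yes; no; contradiction)

private variable
  c e j j′ p q t : ℕ

m+m≤n+n⇒m≤n : ∀ {m n} → m + m ≤ n + n → m ≤ n
m+m≤n+n⇒m≤n {m} {n} h with m ≤? n
... | yes m≤n = m≤n
... | no m≰n  = contradiction h (<⇒≱ (+-mono-< (≰⇒> m≰n) (≰⇒> m≰n)))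

1+m+m≤n+n⇒m<n : ∀ {m n} → suc (m + m) ≤ n + n → m < n
1+m+m≤n+n⇒m<n {m} {n} h with n ≤? m
... | yes n≤m = contradiction h (<⇒≱ (s≤s (+-mono-≤ n≤m n≤m)))
... | no n≰m  = ≰⇒> n≰m

m⊓n≤o∧o<m⇒n≤o : ∀ {m n o} → m ⊓ n ≤ o → o < m → n ≤ o
m⊓n≤o∧o<m⇒n≤o {m} {n} m⊓n≤o o<m with m ≤? n
... | yes m≤n = contradiction (subst (_≤ _) (m≤n⇒m⊓n≡m m≤n) m⊓n≤o) (<⇒≱ o<m)
... | no m≰n  = subst (_≤ _) (m≥n⇒m⊓n≡n (<⇒≤ (≰⇒> m≰n))) m⊓n≤o

o<m⊔n∧m≤o⇒o<n : ∀ {m n o} → o < m ⊔ n → m ≤ o → o < n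
o<m⊔n∧m≤o⇒o<n {m} {n} o<m⊔n m≤o with m ≤? n
... | yes m≤n = subst (_ <_) (m≤n⇒m⊔n≡n m≤n) o<m⊔n
... | no m≰n  = contradiction (subst (_ <_) (m≥n⇒m⊔n≡m (<⇒≤ (≰⇒> m≰n))) o<m⊔n) (≤⇒≯ m≤o)

data EvenOrOdd (r : ℕ) : Set where
  even : ∀ u → r ≡ u + u → EvenOrOdd r
  odd  : ∀ u → r ≡ suc (u + u) → EvenOrOdd r

evenOrOdd : ∀ r → EvenOrOdd r
evenOrOdd zero          = even 0 refl
evenOrOdd (suc zero)    = odd 0 refl
evenOrOdd (suc (suc r)) with evenOrOdd r
... | even u refl = even (suc u) (cong suc (sym (+-suc u u)))
... | odd u refl  = odd (suc u) (cong (suc ∘ suc) (sym (+-suc u u)))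

length-unique-⇔ : ∀ {A : Set} {xs ys : List A} → Unique xs → Unique ys →
                  (∀ x → x ∈ xs ⇔ x ∈ ys) → length xs ≡ length ys
length-unique-⇔ uxs uys xs⇔ys = ↭-length (∼bag⇒↭ (unique∧set⇒bag uxs uys (λ {x} → xs⇔ys x)))

HasDef-functional : ∀ {lam θ mu d d′} → HasDef lam θ mu d → HasDef lam θ mu d′ → d ≡ d′
HasDef-functional (xs , uxs , xs⇔ , refl) (ys , uys , ys⇔ , refl) =
  length-unique-⇔ uxs uys (λ x → ⇔.trans (xs⇔ x) (⇔.sym (ys⇔ x)))

rowInterval : ℕ → ℕ → List Cell
rowInterval lo len = applyUpTo (λ i → 0 , lo + i) len

rowInterval-unique : ∀ lo len → Unique (rowInterval lo len)
rowInterval-unique lo len = applyUpTo⁺₁ _ len λ i<j _ eq → <⇒≢ i<j (+-cancelˡ-≡ lo _ _ (cong proj₂ eq))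

∈-rowInterval⁺ : ∀ {lo len c} → lo ≤ c → c < lo + len → (0 , c) ∈ rowInterval lo len
∈-rowInterval⁺ {lo} {len} {c} lo≤c c<lo+len =
  subst (λ x → (0 , x) ∈ rowInterval lo len) (m+[n∸m]≡n lo≤c)
        (∈-applyUpTo⁺ _ (+-cancelˡ-< lo _ _ (subst (_< lo + len) (sym (m+[n∸m]≡n lo≤c)) c<lo+len)))

∈-rowInterval⁻ : ∀ {lo len x} → x ∈ rowInterval lo len → ∃ λ c → x ≡ (0 , c) × lo ≤ c × c < lo + len
∈-rowInterval⁻ {lo} x∈ with ∈-applyUpTo⁻ _ x∈
... | i , i<len , refl = lo + i , refl , m≤m+n lo i , +-monoʳ-< lo i<len

upperLabel : ℕ → ℕ → ℕ
upperLabel k c = 2 + k + (c + c)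

module Deficit (k n : ℕ) where

  upperBelow : ℕ → ℕ
  upperBelow j = n ⊓ (j ∸ k)

  bottomLabel : ℕ → ℕ
  bottomLabel j = suc (j + upperBelow j)

  upperBelow-≤k : j ≤ k → upperBelow j ≡ 0
  upperBelow-≤k j≤k = trans (cong (n ⊓_) (m≤n⇒m∸n≡0 j≤k)) (⊓-zeroʳ n)

  upperBelow-k+ : t ≤ n → upperBelow (k + t) ≡ t
  upperBelow-k+ {t} t≤n = trans (cong (n ⊓_) (m+n∸m≡n k t)) (m≥n⇒m⊓n≡n t≤n)

  upperBelow-k+n+ : ∀ e → upperBelow (k + n + e) ≡ n
  upperBelow-k+n+ e = begin
    n ⊓ (k + n + e ∸ k)   ≡⟨ cong (λ x → n ⊓ (x ∸ k)) (+-assoc k n e) ⟩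
    n ⊓ (k + (n + e) ∸ k) ≡⟨ cong (n ⊓_) (m+n∸m≡n k (n + e)) ⟩
    n ⊓ (n + e)           ≡⟨ m≤n⇒m⊓n≡m (m≤m+n n e) ⟩
    n                     ∎
    where open ≡-Reasoning

  upperBelow-mono : j ≤ j′ → upperBelow j ≤ upperBelow j′
  upperBelow-mono j≤j′ = ⊓-monoʳ-≤ n (∸-monoˡ-≤ k j≤j′)

  upperBelow≤n : ∀ j → upperBelow j ≤ n
  upperBelow≤n j = m⊓n≤m n (j ∸ k)

  upperBelow≤id : ∀ j → upperBelow j ≤ j
  upperBelow≤id j = ≤-trans (m⊓n≤n n (j ∸ k)) (m∸n≤m j k)

  upperLabel<bottomLabel : c < upperBelow j → upperLabel k c < bottomLabel j
  upperLabel<bottomLabel {c} {j} c<h = s≤s (begin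
    2 + k + (c + c)        ≡⟨ solve (k ∷ c ∷ []) ⟩
    suc c + k + suc c      ≤⟨ +-mono-≤ 1+c+k≤j c<h ⟩
    j + upperBelow j       ∎)
    where
    open ≤-Reasoning
    1+c≤j∸k : suc c ≤ j ∸ k
    1+c≤j∸k = ≤-trans c<h (m⊓n≤n n (j ∸ k))
    k<j : k < j
    k<j = m∸n≢0⇒n<m λ j∸k≡0 → contradiction (subst (suc c ≤_) j∸k≡0 1+c≤j∸k) λ ()
    1+c+k≤j : suc c + k ≤ j
    1+c+k≤j = m≤o∸n⇒m+n≤o (suc c) (<⇒≤ k<j) 1+c≤j∸k

  bottomLabel<upperLabel : upperBelow j ≤ c → c < n → bottomLabel j < upperLabel k c
  bottomLabel<upperLabel {j} {c} h≤c c<n = s≤s (s≤s (begin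
    j + upperBelow j       ≤⟨ +-mono-≤ j≤k+c h≤c ⟩
    k + c + c              ≡⟨ +-assoc k c c ⟩
    k + (c + c)            ∎))
    where
    open ≤-Reasoning
    j≤k+c : j ≤ k + c
    j≤k+c = ≤-trans (m≤n+m∸n j k) (+-monoʳ-≤ k (m⊓n≤o∧o<m⇒n≤o h≤c c<n))

  data Column : ℕ → Set where
    before : j < k → Column j
    during : ∀ t → t < n → Column (k + t)
    after  : ∀ e → Column (k + n + e)

  column : ∀ j → Column j
  column j with j <? k
  ... | yes j<k = before j<k
  ... | no j≮k with m≤n⇒∃[o]m+o≡n (≮⇒≥ j≮k)
  ...   | t , refl with t <? n
  ...     | yes t<n = during t t<n
  ...     | no t≮n with m≤n⇒∃[o]m+o≡n (≮⇒≥ t≮n)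
  ...       | e , refl = subst Column (+-assoc k n e) (after e)

  data Step (j : ℕ) : Set where
    flat : ∀ {h} → upperBelow j ≡ h → upperBelow (suc j) ≡ h →
           (∀ c → c < n → upperLabel k c ≢ 2 + (j + h)) → Step j
    rise : ∀ {h} → upperBelow j ≡ h → h < n → upperBelow (suc j) ≡ suc h →
           2 + (j + h) ≡ upperLabel k h → (∀ c → upperLabel k c ≢ 3 + (j + h)) → Step j

  step : ∀ j → Step j
  step j with column j
  ... | before j<k =
    flat (upperBelow-≤k (<⇒≤ j<k)) (upperBelow-≤k j<k) λ c _ eq → <⇒≢ (next<upper c) (sym eq)
    where
    open ≤-Reasoning
    next<upper : ∀ c → 2 + (j + 0) < upperLabel k c
    next<upper c = begin-strict
      2 + (j + 0)            ≡⟨ cong (2 +_) (+-identityʳ j) ⟩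
      2 + j                  <⟨ s≤s (s≤s j<k) ⟩
      2 + k                  ≤⟨ m≤m+n (2 + k) (c + c) ⟩
      upperLabel k c         ∎
  ... | during t t<n =
    rise (upperBelow-k+ (<⇒≤ t<n)) t<n (trans (cong upperBelow (sym (+-suc k t))) (upperBelow-k+ t<n))
         (cong (2 +_) (+-assoc k t t))
         λ c eq → even≢odd c t (+-cancelˡ-≡ (2 + k) _ _ (begin
           2 + k + 2 * c        ≡⟨ solve (k ∷ c ∷ []) ⟩
           2 + k + (c + c)      ≡⟨ eq ⟩
           3 + (k + t + t)      ≡⟨ solve (k ∷ t ∷ []) ⟩
           2 + k + suc (2 * t)  ∎))
    where open ≡-Reasoning
  ... | after e =
    flat (upperBelow-k+n+ e) (trans (cong upperBelow (sym (+-suc (k + n) e))) (upperBelow-k+n+ (suc e)))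
         λ c c<n eq → <⇒≢ (upper<next c c<n) eq
    where
    open ≤-Reasoning
    upper<next : ∀ c → c < n → upperLabel k c < 2 + (k + n + e + n)
    upper<next c c<n = begin-strict
      2 + k + (c + c)        <⟨ +-monoʳ-< (2 + k) (+-mono-< c<n c<n) ⟩
      2 + k + (n + n)        ≤⟨ m≤m+n _ e ⟩
      2 + k + (n + n) + e    ≡⟨ solve (k ∷ n ∷ e ∷ []) ⟩
      2 + (k + n + e + n)    ∎

  deficitStart deficitEnd defect : ℕ × ℕ → ℕ
  deficitStart (p , q) = q ⊓ upperBelow p
  deficitEnd   (p , q) = q ⊔ upperBelow (pred p)
  defect μ = deficitEnd μ ∸ deficitStart μ

  deficitCells : ℕ × ℕ → List Cell
  deficitCells μ = rowInterval (deficitStart μ) (defect μ)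

  deficitStart≤deficitEnd : ∀ μ → deficitStart μ ≤ deficitEnd μ
  deficitStart≤deficitEnd (p , q) = ≤-trans (m⊓n≤m q (upperBelow p)) (m≤m⊔n q (upperBelow (pred p)))

  ∈-deficitCells⁺ : ∀ μ → deficitStart μ ≤ c → c < deficitEnd μ → (0 , c) ∈ deficitCells μ
  ∈-deficitCells⁺ μ start≤c c<end =
    ∈-rowInterval⁺ start≤c (subst (_ <_) (sym (m+[n∸m]≡n (deficitStart≤deficitEnd μ))) c<end)

  ∈-deficitCells⁻ : ∀ μ {x} → x ∈ deficitCells μ →
                    ∃ λ c → x ≡ (0 , c) × deficitStart μ ≤ c × c < deficitEnd μ
  ∈-deficitCells⁻ μ x∈ with ∈-rowInterval⁻ x∈
  ... | c , refl , start≤c , c<start+len =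
    c , refl , start≤c , subst (c <_) (m+[n∸m]≡n (deficitStart≤deficitEnd μ)) c<start+len

  data Region : ℕ × ℕ → Set where
    low   : p ≤ k → q ≤ n → Region (p , q)
    above : ∀ t e → suc t + e ≤ n → Region (k + suc t , suc t + e)
    below : ∀ q e → suc (q + e) ≤ n → Region (k + suc (q + e) , q)
    high  : ∀ e → q ≤ n → Region (suc (k + n + e) , q)

  region-beyond-k : ∀ t q → q ≤ n → Region (k + suc t , q)
  region-beyond-k t q q≤n with suc t ≤? n | suc t ≤? q
  ... | no 1+t≰n | _ with m≤n⇒∃[o]m+o≡n (≤-pred (≰⇒> 1+t≰n))
  ...   | e , refl = subst (λ p → Region (p , q)) 1+k+n+e≡k+1+n+e (high e q≤n)
    where
    1+k+n+e≡k+1+n+e : suc (k + n + e) ≡ k + suc (n + e)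
    1+k+n+e≡k+1+n+e = trans (cong suc (+-assoc k n e)) (sym (+-suc k (n + e)))
  region-beyond-k t q q≤n | yes 1+t≤n | yes 1+t≤q with m≤n⇒∃[o]m+o≡n 1+t≤q
  ...   | e , refl = above t e q≤n
  region-beyond-k t q q≤n | yes 1+t≤n | no 1+t≰q with m≤n⇒∃[o]m+o≡n (≤-pred (≰⇒> 1+t≰q))
  ...   | e , refl = below q e 1+t≤n

  region : ∀ p q → q ≤ n → Region (p , q)
  region p q q≤n with p ≤? k
  ... | yes p≤k = low p≤k q≤n
  ... | no p≰k with m≤n⇒∃[o]m+o≡n (≰⇒> p≰k)
  ...   | t , refl = subst (λ p → Region (p , q)) (+-suc k t) (region-beyond-k t q q≤n)

  defect-low : p ≤ k → defect (p , q) ≡ q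
  defect-low {p} {q} p≤k
    rewrite upperBelow-≤k (≤-trans pred[n]≤n p≤k) | upperBelow-≤k p≤k
          | ⊔-identityʳ q | ⊓-zeroʳ q = refl

  defect-above : suc t ≤ n → defect (k + suc t , suc t + e) ≡ e
  defect-above {t} {e} 1+t≤n
    rewrite cong pred (+-suc k t) | upperBelow-k+ (<⇒≤ 1+t≤n) | upperBelow-k+ 1+t≤n
          | m≥n⇒m⊔n≡m (m≤n⇒m≤1+n (m≤m+n t e)) | m≥n⇒m⊓n≡n (m≤m+n t e) = m+n∸m≡n t e

  defect-below : suc (q + e) ≤ n → defect (k + suc (q + e) , q) ≡ e
  defect-below {q} {e} 1+q+e≤n
    rewrite cong pred (+-suc k (q + e)) | upperBelow-k+ (<⇒≤ 1+q+e≤n) | upperBelow-k+ 1+q+e≤n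
          | m≤n⇒m⊔n≡n (m≤m+n q e) | m≤n⇒m⊓n≡m (m≤n⇒m≤1+n (m≤m+n q e)) = m+n∸m≡n q e

  defect-high : q ≤ n → defect (suc (k + n + e) , q) ≡ n ∸ q
  defect-high {q} {e} q≤n
    rewrite sym (+-suc (k + n) e) | upperBelow-k+n+ e | upperBelow-k+n+ (suc e)
          | m≤n⇒m⊔n≡n q≤n | m≤n⇒m⊓n≡m q≤n = refl

  -- For r ≥ 1, zigzag d r = (p ∸ k , q) for the μ = (p , q) with k < p ≤ k + n, defect d and
  -- size k + d + r; the parity of r decides whether q ≥ p ∸ k.
  zigzag : ℕ → ℕ → ℕ × ℕ
  zigzag d zero          = 0 , d
  zigzag d (suc zero)    = suc d , 0
  zigzag d (suc (suc r)) = map suc suc (zigzag d r)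

  zigzag-even : ∀ d t → zigzag d (t + t) ≡ (t , t + d)
  zigzag-even d zero = refl
  zigzag-even d (suc t) rewrite +-suc t t | zigzag-even d t = refl

  zigzag-odd : ∀ d q → zigzag d (suc (q + q)) ≡ (suc (q + d) , q)
  zigzag-odd d zero = refl
  zigzag-odd d (suc q) rewrite +-suc q q | zigzag-odd d q = refl

  fromDefectSize : ℕ → ℕ → ℕ × ℕ
  fromDefectSize d s with s ≤? k + d | k + n + n <? s + d
  ... | yes _ | _     = s ∸ d , d
  ... | no _  | yes _ = s + d ∸ n , n ∸ d
  ... | no _  | no _  = map₁ (k +_) (zigzag d (s ∸ (k + d)))

  fromDefectSize-low : ∀ {s d} → s ≤ k + d → fromDefectSize d s ≡ (s ∸ d , d)
  fromDefectSize-low {s} {d} s≤k+d with s ≤? k + d | k + n + n <? s + d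
  ... | yes _ | _ = refl
  ... | no s≰k+d | _ = contradiction s≤k+d s≰k+d

  fromDefectSize-high : ∀ {s d} → s ≰ k + d → k + n + n < s + d →
                        fromDefectSize d s ≡ (s + d ∸ n , n ∸ d)
  fromDefectSize-high {s} {d} s≰k+d k+n+n<s+d with s ≤? k + d | k + n + n <? s + d
  ... | yes s≤k+d | _ = contradiction s≤k+d s≰k+d
  ... | no _ | yes _ = refl
  ... | no _ | no k+n+n≮s+d = contradiction k+n+n<s+d k+n+n≮s+d

  fromDefectSize-middle : ∀ {s d} → s ≰ k + d → k + n + n ≮ s + d →
                          fromDefectSize d s ≡ map₁ (k +_) (zigzag d (s ∸ (k + d)))
  fromDefectSize-middle {s} {d} s≰k+d k+n+n≮s+d with s ≤? k + d | k + n + n <? s + d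
  ... | yes s≤k+d | _ = contradiction s≤k+d s≰k+d
  ... | no _ | yes k+n+n<s+d = contradiction k+n+n<s+d k+n+n≮s+d
  ... | no _ | no _ = refl

  size : ℕ × ℕ → ℕ
  size (p , q) = p + q

  size-above : ∀ t e → k + suc t + (suc t + e) ≡ k + e + (suc t + suc t)
  size-above t e = solve (k ∷ t ∷ e ∷ [])

  size-below : ∀ q e → k + suc (q + e) + q ≡ k + e + suc (q + q)
  size-below q e = solve (k ∷ q ∷ e ∷ [])

  size+defect-above≤ : suc t + e ≤ n → k + suc t + (suc t + e) + e ≤ k + n + n
  size+defect-above≤ {t} {e} 1+t+e≤n = begin
    k + suc t + (suc t + e) + e     ≡⟨ solve (k ∷ t ∷ e ∷ []) ⟩
    k + (suc t + e) + (suc t + e)   ≤⟨ +-mono-≤ (+-monoʳ-≤ k 1+t+e≤n) 1+t+e≤n ⟩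
    k + n + n                       ∎
    where open ≤-Reasoning

  size+defect-below≤ : suc (q + e) ≤ n → k + suc (q + e) + q + e ≤ k + n + n
  size+defect-below≤ {q} {e} 1+q+e≤n = begin
    k + suc (q + e) + q + e         ≡⟨ solve (k ∷ q ∷ e ∷ []) ⟩
    k + (q + e) + suc (q + e)       ≤⟨ +-mono-≤ (+-monoʳ-≤ k (<⇒≤ 1+q+e≤n)) 1+q+e≤n ⟩
    k + n + n                       ∎
    where open ≤-Reasoning

  fromDefectSize-band : ∀ {d s r} → s ≡ k + d + suc r → s + d ≤ k + n + n →
                        fromDefectSize d s ≡ map₁ (k +_) (zigzag d (suc r))
  fromDefectSize-band {d} {r = r} refl s+d≤k+n+n =
    trans (fromDefectSize-middle (m+1+n≰m (k + d)) (≤⇒≯ s+d≤k+n+n))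
          (cong (map₁ (k +_) ∘ zigzag d) (m+n∸m≡n (k + d) (suc r)))

  fromDefectSize-defect : ∀ p q → q ≤ n → fromDefectSize (defect (p , q)) (size (p , q)) ≡ (p , q)
  fromDefectSize-defect p q q≤n with region p q q≤n
  ... | low p≤k _ = begin
    fromDefectSize (defect (p , q)) (p + q) ≡⟨ cong (λ d → fromDefectSize d (p + q)) (defect-low p≤k) ⟩
    fromDefectSize q (p + q)                ≡⟨ fromDefectSize-low (+-monoˡ-≤ q p≤k) ⟩
    (p + q ∸ q , q)                         ≡⟨ cong (_, q) (m+n∸n≡m p q) ⟩
    (p , q)                                 ∎
    where open ≡-Reasoning
  ... | above t e 1+t+e≤n = begin
    fromDefectSize (defect μ) (size μ)
      ≡⟨ cong (λ d → fromDefectSize d (size μ)) (defect-above (≤-trans (m≤m+n (suc t) e) 1+t+e≤n)) ⟩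
    fromDefectSize e (size μ)
      ≡⟨ fromDefectSize-band (size-above t e) (size+defect-above≤ 1+t+e≤n) ⟩
    map₁ (k +_) (zigzag e (suc t + suc t))
      ≡⟨ cong (map₁ (k +_)) (zigzag-even e (suc t)) ⟩
    μ ∎
    where
    open ≡-Reasoning
    μ : ℕ × ℕ
    μ = k + suc t , suc t + e
  ... | below q e 1+q+e≤n = begin
    fromDefectSize (defect μ) (size μ)
      ≡⟨ cong (λ d → fromDefectSize d (size μ)) (defect-below 1+q+e≤n) ⟩
    fromDefectSize e (size μ)
      ≡⟨ fromDefectSize-band (size-below q e) (size+defect-below≤ 1+q+e≤n) ⟩
    map₁ (k +_) (zigzag e (suc (q + q)))
      ≡⟨ cong (map₁ (k +_)) (zigzag-odd e q) ⟩
    μ ∎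
    where
    open ≡-Reasoning
    μ : ℕ × ℕ
    μ = k + suc (q + e) , q
  ... | high e q≤n = begin
    fromDefectSize (defect (p′ , q)) (p′ + q)
      ≡⟨ cong (λ d → fromDefectSize d (p′ + q)) (defect-high q≤n) ⟩
    fromDefectSize (n ∸ q) (p′ + q)
      ≡⟨ fromDefectSize-high size≰k+d k+n+n<size+d ⟩
    (p′ + q + (n ∸ q) ∸ n , n ∸ (n ∸ q))
      ≡⟨ cong₂ _,_ (trans (cong (_∸ n) size+d≡) (m+n∸n≡m p′ n)) (m∸[m∸n]≡n q≤n) ⟩
    (p′ , q) ∎
    where
    open ≡-Reasoning
    p′ : ℕ
    p′ = suc (k + n + e)
    size+d≡ : p′ + q + (n ∸ q) ≡ p′ + n
    size+d≡ = trans (+-assoc p′ q (n ∸ q)) (cong (p′ +_) (m+[n∸m]≡n q≤n))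
    size≰k+d : p′ + q ≰ k + (n ∸ q)
    size≰k+d = <⇒≱ (s≤s (≤-trans (+-monoʳ-≤ k (m∸n≤m n q))
                                  (≤-trans (m≤m+n (k + n) e) (m≤m+n (k + n + e) q))))
    k+n+n<size+d : k + n + n < p′ + q + (n ∸ q)
    k+n+n<size+d = subst (k + n + n <_) (sym size+d≡) (s≤s (+-monoˡ-≤ n (m≤m+n (k + n) e)))

module Classification (k n m : ℕ) (n≤1+k : n ≤ suc k) (k+n≤m : k + n ≤ m) where

  open Deficit k n

  InRange : ℕ → ℕ → Set
  InRange d s = d ≤ n × d + n ≤ m × d + d ≤ s × s + d ≤ m + n

  <n⇒≤k : ∀ {d} → d < n → d ≤ k
  <n⇒≤k d<n = ≤-pred (≤-trans d<n n≤1+k)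

  inRange-below-k : ∀ {d s} → d ≤ k → d ≤ n → d + d ≤ s → s + d ≤ k + n + n → InRange d s
  inRange-below-k d≤k d≤n d+d≤s s+d≤k+n+n =
    d≤n , ≤-trans (+-monoˡ-≤ _ d≤k) k+n≤m , d+d≤s , ≤-trans s+d≤k+n+n (+-monoˡ-≤ n k+n≤m)

  inRange-defect : ∀ p q → q ≤ p → p ≤ m → q ≤ n → InRange (defect (p , q)) (size (p , q))
  inRange-defect p q q≤p p≤m q≤n with region p q q≤n
  ... | low p≤k _ = subst (λ d → InRange d (p + q)) (sym (defect-low p≤k))
    (inRange-below-k (≤-trans q≤p p≤k) q≤n (+-monoˡ-≤ q q≤p)
                     (+-mono-≤ (+-mono-≤ p≤k q≤n) q≤n))
  ... | above t e 1+t+e≤n = subst (λ d → InRange d (size (k + suc t , suc t + e)))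
    (sym (defect-above (≤-trans (m≤m+n (suc t) e) 1+t+e≤n)))
    (inRange-below-k e≤k (≤-trans (m≤n+m e (suc t)) 1+t+e≤n)
                     (+-mono-≤ (≤-trans e≤k (m≤m+n k (suc t))) (m≤n+m e (suc t)))
                     (size+defect-above≤ 1+t+e≤n))
    where
    e≤k : e ≤ k
    e≤k = <n⇒≤k (≤-trans (s≤s (m≤n+m e t)) 1+t+e≤n)
  ... | below q e 1+q+e≤n = subst (λ d → InRange d (size (k + suc (q + e) , q)))
    (sym (defect-below 1+q+e≤n))
    (inRange-below-k e≤k (<⇒≤ e<n)
                     (≤-trans (+-mono-≤ e≤k (≤-trans (m≤n+m e q) (n≤1+n _))) (m≤m+n _ q))
                     (size+defect-below≤ 1+q+e≤n))
    where
    e<n : e < n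
    e<n = ≤-trans (s≤s (m≤n+m e q)) 1+q+e≤n
    e≤k : e ≤ k
    e≤k = <n⇒≤k e<n
  ... | high e q≤n = subst (λ d → InRange d (p + q)) (sym (defect-high q≤n))
    (m∸n≤m n q , ≤-trans (+-monoˡ-≤ n (m∸n≤m n q)) (≤-trans n+n≤p p≤m) ,
     ≤-trans (+-mono-≤ (m∸n≤m n q) (m∸n≤m n q)) (≤-trans n+n≤p (m≤m+n p q)) ,
     subst (_≤ m + n) (sym size+d≡) (+-monoˡ-≤ n p≤m))
    where
    n+n≤p : n + n ≤ p
    n+n≤p = ≤-trans (+-monoˡ-≤ n n≤1+k) (s≤s (m≤m+n (k + n) e))
    size+d≡ : p + q + (n ∸ q) ≡ p + n
    size+d≡ = trans (+-assoc p q (n ∸ q)) (cong (p +_) (m+[n∸m]≡n q≤n))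

  Preimage : ℕ → ℕ → Set
  Preimage d s = Σ (ℕ × ℕ) λ μ → Subpartition μ (m , n) × defect μ ≡ d × size μ ≡ s

  preimage-low : ∀ {d s} → d ≤ n → d + d ≤ s → s ≤ k + d → Preimage d s
  preimage-low {d} {s} d≤n d+d≤s s≤k+d =
    (s ∸ d , d) , (m+n≤o⇒m≤o∸n d d+d≤s , ≤-trans s∸d≤k (m+n≤o⇒m≤o k k+n≤m) , d≤n) ,
    defect-low s∸d≤k , m∸n+n≡m (≤-trans (m≤m+n d d) d+d≤s)
    where
    s∸d≤k : s ∸ d ≤ k
    s∸d≤k = m≤n+o⇒m∸n≤o s d (subst (s ≤_) (+-comm k d) s≤k+d)

  preimage-high : ∀ {d s} → d ≤ n → s + d ≤ m + n → k + n + n < s + d → Preimage d s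
  preimage-high {d} {s} d≤n s+d≤m+n k+n+n<s+d with m≤n⇒∃[o]m+o≡n k+n+n<s+d
  ... | g , s+d≡ =
    (p′ , n ∸ d) ,
    (≤-trans (m∸n≤m n d) n≤p′ , +-cancelʳ-≤ n p′ m (subst (_≤ m + n) (sym p′+n≡s+d) s+d≤m+n) , m∸n≤m n d) ,
    trans (defect-high (m∸n≤m n d)) (m∸[m∸n]≡n d≤n) ,
    +-cancelʳ-≡ d _ s (begin
      p′ + (n ∸ d) + d ≡⟨ +-assoc p′ (n ∸ d) d ⟩
      p′ + (n ∸ d + d) ≡⟨ cong (p′ +_) (m∸n+n≡m d≤n) ⟩
      p′ + n           ≡⟨ p′+n≡s+d ⟩
      s + d           ∎)
    where
    open ≡-Reasoning
    p′ : ℕ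
    p′ = suc (k + n + g)
    p′+n≡s+d : p′ + n ≡ s + d
    p′+n≡s+d = trans regroup s+d≡
      where
      regroup : suc (k + n + g) + n ≡ suc (k + n + n) + g
      regroup = solve (k ∷ n ∷ g ∷ [])
    n≤p′ : n ≤ p′
    n≤p′ = ≤-trans (m≤n+m n k) (≤-trans (m≤m+n (k + n) g) (n≤1+n _))

  preimage-above : ∀ {d} t → k + d + (suc t + suc t) + d ≤ k + n + n → Preimage d (k + d + (suc t + suc t))
  preimage-above {d} t s+d≤k+n+n =
    (k + suc t , suc t + d) , (q≤p , p≤m , 1+t+d≤n) ,
    defect-above (≤-trans (m≤m+n (suc t) d) 1+t+d≤n) , size-above t d
    where
    open ≤-Reasoning
    1+t+d≤n : suc t + d ≤ n
    1+t+d≤n = m+m≤n+n⇒m≤n (+-cancelˡ-≤ k _ _ (begin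
      k + ((suc t + d) + (suc t + d))  ≡⟨ solve (k ∷ t ∷ d ∷ []) ⟩
      k + d + (suc t + suc t) + d      ≤⟨ s+d≤k+n+n ⟩
      k + n + n                        ≡⟨ +-assoc k n n ⟩
      k + (n + n)                      ∎))
    q≤p : suc t + d ≤ k + suc t
    q≤p = begin
      suc t + d  ≤⟨ +-monoʳ-≤ (suc t) (<n⇒≤k (≤-trans (s≤s (m≤n+m d t)) 1+t+d≤n)) ⟩
      suc t + k  ≡⟨ +-comm (suc t) k ⟩
      k + suc t  ∎
    p≤m : k + suc t ≤ m
    p≤m = ≤-trans (+-monoʳ-≤ k (≤-trans (m≤m+n (suc t) d) 1+t+d≤n)) k+n≤m

  preimage-below : ∀ {d} u → k + d + suc (u + u) + d ≤ k + n + n → Preimage d (k + d + suc (u + u))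
  preimage-below {d} u s+d≤k+n+n =
    (k + suc (u + d) , u) , (q≤p , p≤m , ≤-trans (m≤m+n u d) (<⇒≤ 1+u+d≤n)) ,
    defect-below 1+u+d≤n , size-below u d
    where
    open ≤-Reasoning
    1+u+d≤n : suc (u + d) ≤ n
    1+u+d≤n = 1+m+m≤n+n⇒m<n (+-cancelˡ-≤ k _ _ (begin
      k + suc ((u + d) + (u + d))      ≡⟨ solve (k ∷ u ∷ d ∷ []) ⟩
      k + d + suc (u + u) + d          ≤⟨ s+d≤k+n+n ⟩
      k + n + n                        ≡⟨ +-assoc k n n ⟩
      k + (n + n)                      ∎))
    q≤p : u ≤ k + suc (u + d)
    q≤p = ≤-trans (m≤m+n u d) (≤-trans (n≤1+n _) (m≤n+m _ k))
    p≤m : k + suc (u + d) ≤ m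
    p≤m = ≤-trans (+-monoʳ-≤ k 1+u+d≤n) k+n≤m

  preimage-middle : ∀ {d s} → s ≰ k + d → s + d ≤ k + n + n → Preimage d s
  preimage-middle {d} s≰k+d s+d≤k+n+n with m≤n⇒∃[o]m+o≡n (<⇒≤ (≰⇒> s≰k+d))
  ... | r , refl with evenOrOdd r
  ... | even zero refl    = contradiction (≤-reflexive (+-identityʳ (k + d))) s≰k+d
  ... | even (suc t) refl = preimage-above t s+d≤k+n+n
  ... | odd u refl        = preimage-below u s+d≤k+n+n

  preimage : ∀ {d s} → d ≤ n → d + d ≤ s → s + d ≤ m + n → Preimage d s
  preimage {d} {s} d≤n d+d≤s s+d≤m+n with s ≤? k + d | k + n + n <? s + d
  ... | yes s≤k+d | _              = preimage-low d≤n d+d≤s s≤k+d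
  ... | no _      | yes k+n+n<s+d  = preimage-high d≤n s+d≤m+n k+n+n<s+d
  ... | no s≰k+d  | no k+n+n≮s+d   = preimage-middle s≰k+d (≮⇒≥ k+n+n≮s+d)

  subpartition-admissible : ∀ {μ} → Subpartition μ (m , n) →
    defect μ ≤ min n (m ∸ n) × defect μ ≤ area (m , n) μ × area (m , n) μ + 2 * defect μ ≤ m + n
  subpartition-admissible {p , q} (q≤p , p≤m , q≤n) with inRange-defect p q q≤p p≤m q≤n
  ... | d≤n , d+n≤m , d+d≤s , s+d≤m+n =
    ⊓-glb d≤n (m+n≤o⇒m≤o∸n _ d+n≤m) ,
    m+n≤o⇒m≤o∸n _ (subst (_≤ m + n) (+-comm (p + q) _) s+d≤m+n) ,
    (begin
      m + n ∸ (p + q) + 2 * d    ≡⟨ cong (m + n ∸ (p + q) +_) (cong (d +_) (+-identityʳ d)) ⟩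
      m + n ∸ (p + q) + (d + d)  ≤⟨ +-monoʳ-≤ (m + n ∸ (p + q)) d+d≤s ⟩
      m + n ∸ (p + q) + (p + q)  ≡⟨ m∸n+n≡m (m+n≤o⇒m≤o (p + q) s+d≤m+n) ⟩
      m + n                      ∎)
    where
    open ≤-Reasoning
    d : ℕ
    d = defect (p , q)

  admissible-preimage : ∀ {d a} → d ≤ min n (m ∸ n) → d ≤ a → a + 2 * d ≤ m + n →
    Σ (ℕ × ℕ) λ μ → Subpartition μ (m , n) × defect μ ≡ d × area (m , n) μ ≡ a
  admissible-preimage {d} {a} d≤min d≤a a+2d≤m+n =
    let μ , sub , defect≡d , size≡ = preimage (m≤n⊓o⇒m≤n n (m ∸ n) d≤min) d+d≤s s+d≤m+n in
    μ , sub , defect≡d , trans (cong (m + n ∸_) size≡) (m∸[m∸n]≡n a≤m+n)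
    where
    open ≤-Reasoning
    a≤m+n : a ≤ m + n
    a≤m+n = ≤-trans (m≤m+n a (2 * d)) a+2d≤m+n
    d+d≤s : d + d ≤ m + n ∸ a
    d+d≤s = m+n≤o⇒m≤o∸n (d + d) (begin
      d + d + a      ≡⟨ solve (d ∷ a ∷ []) ⟩
      a + 2 * d      ≤⟨ a+2d≤m+n ⟩
      m + n          ∎)
    s+d≤m+n : m + n ∸ a + d ≤ m + n
    s+d≤m+n = begin
      m + n ∸ a + d  ≤⟨ +-monoʳ-≤ (m + n ∸ a) d≤a ⟩
      m + n ∸ a + a  ≡⟨ m∸n+n≡m a≤m+n ⟩
      m + n          ∎

  defect-area-injective : ∀ {μ μ′} → Subpartition μ (m , n) → Subpartition μ′ (m , n) →
                          defect μ ≡ defect μ′ → area (m , n) μ ≡ area (m , n) μ′ → μ ≡ μ′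
  defect-area-injective {p , q} {p′ , q′} (_ , p≤m , q≤n) (_ , p′≤m , q′≤n) defect≡ area≡ = begin
    (p , q)                                     ≡⟨ sym (fromDefectSize-defect p q q≤n) ⟩
    fromDefectSize (defect (p , q)) (p + q)     ≡⟨ cong₂ fromDefectSize defect≡ size≡ ⟩
    fromDefectSize (defect (p′ , q′)) (p′ + q′) ≡⟨ fromDefectSize-defect p′ q′ q′≤n ⟩
    (p′ , q′)                                   ∎
    where
    open ≡-Reasoning
    size≡ : p + q ≡ p′ + q′
    size≡ = ∸-cancelˡ-≡ (+-mono-≤ p≤m q≤n) (+-mono-≤ p′≤m q′≤n) area≡

module RowRegularTableau
  {m n k : ℕ} {θ : ℕ → ℕ → ℕ} (syt : SYT m n θ)
  (upper : ∀ c → c < n → θ 1 c ≡ upperLabel k c) (k+n≤m : k + n ≤ m) where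

  open Deficit k n

  label-bounds : ∀ ℓ c → (ℓ , c) ∈ₚ (m , n) → 1 ≤ θ ℓ c × θ ℓ c ≤ m + n
  label-bounds = proj₁ syt

  label-injective : ∀ ℓ c ℓ′ c′ → (ℓ , c) ∈ₚ (m , n) → (ℓ′ , c′) ∈ₚ (m , n) →
                    θ ℓ c ≡ θ ℓ′ c′ → (ℓ , c) ≡ (ℓ′ , c′)
  label-injective = proj₁ (proj₂ syt)

  label-surjective : ∀ x → 1 ≤ x → x ≤ m + n →
                     Σ Cell λ y → y ∈ₚ (m , n) × θ (proj₁ y) (proj₂ y) ≡ x
  label-surjective = proj₁ (proj₂ (proj₂ syt))

  row-increasing : ∀ ℓ c → (ℓ , suc c) ∈ₚ (m , n) → θ ℓ c < θ ℓ (suc c)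
  row-increasing = proj₁ (proj₂ (proj₂ (proj₂ syt)))

  row-strictMono : ∀ ℓ {a b} → a < b → (ℓ , b) ∈ₚ (m , n) → θ ℓ a < θ ℓ b
  row-strictMono ℓ {a} {suc b} a<1+b 1+b∈ with m≤n⇒m<n∨m≡n (≤-pred a<1+b)
  ... | inj₁ a<b  = <-trans (row-strictMono ℓ a<b (<-trans (n<1+n b) 1+b∈)) (row-increasing ℓ b 1+b∈)
  ... | inj₂ refl = row-increasing ℓ a 1+b∈

  row-reflects-≤ : ∀ ℓ {a b} → (ℓ , b) ∈ₚ (m , n) → θ ℓ b ≤ θ ℓ a → b ≤ a
  row-reflects-≤ ℓ b∈ θb≤θa = ≮⇒≥ λ a<b → <⇒≱ (row-strictMono ℓ a<b b∈) θb≤θa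

  row-reflects-< : ∀ ℓ {a b} → (ℓ , a) ∈ₚ (m , n) → θ ℓ a < θ ℓ b → a < b
  row-reflects-< ℓ {a} {b} a∈ θa<θb with <-cmp a b
  ... | tri< a<b _ _ = a<b
  ... | tri≈ _ refl _ = contradiction θa<θb (<-irrefl refl)
  ... | tri> _ _ b<a = contradiction θa<θb (<-asym (row-strictMono ℓ b<a a∈))

  bottom-label : ∀ x → 1 ≤ x → x ≤ m + n → (∀ c → c < n → θ 1 c ≢ x) → ∃ λ j → j < m × θ 0 j ≡ x
  bottom-label x 1≤x x≤m+n avoidsUpper with label-surjective x 1≤x x≤m+n
  ... | (0 , j) , j<m , θj≡x = j , j<m , θj≡x
  ... | (1 , c) , c<n , θc≡x = contradiction θc≡x (avoidsUpper c c<n)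
  ... | (suc (suc _) , _) , () , _

  bottom-squeeze : ∀ {j y} → suc j < m → θ 0 j < y → y ≤ θ 0 (suc j) → (∀ c → c < n → θ 1 c ≢ y) →
                   θ 0 (suc j) ≡ y
  bottom-squeeze {j} 1+j<m θj<y y≤θ[1+j] avoidsUpper
    with bottom-label _ (≤-trans (s≤s z≤n) θj<y)
                        (≤-trans y≤θ[1+j] (proj₂ (label-bounds 0 (suc j) 1+j<m))) avoidsUpper
  ... | j′ , j′<m , refl =
    cong (θ 0) (≤-antisym (row-reflects-< 0 (<-trans (n<1+n j) 1+j<m) θj<y) (row-reflects-≤ 0 j′<m y≤θ[1+j]))

  upperLabel≢⇒θ≢ : ∀ {y} → (∀ c → c < n → upperLabel k c ≢ y) → ∀ c → c < n → θ 1 c ≢ y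
  upperLabel≢⇒θ≢ notUpperLabel c c<n θc≡y = notUpperLabel c c<n (trans (sym (upper c c<n)) θc≡y)

  bottom-next≥ : ∀ {j h} → suc j < m → θ 0 j ≡ suc (j + h) → 2 + (j + h) ≤ θ 0 (suc j)
  bottom-next≥ {j} 1+j<m θj≡ = subst (_< θ 0 (suc j)) θj≡ (row-increasing 0 j 1+j<m)

  bottom≡bottomLabel : ∀ j → j < m → θ 0 j ≡ bottomLabel j
  bottom≡bottomLabel zero 0<m
    with bottom-label 1 ≤-refl (≤-trans 0<m (m≤m+n m n)) (upperLabel≢⇒θ≢ λ c _ → 1+n≢0 ∘ suc-injective)
  ... | j′ , j′<m , θj′≡1 = begin
    θ 0 0          ≡⟨ cong (θ 0) (sym (n≤0⇒n≡0 j′≤0)) ⟩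
    θ 0 j′         ≡⟨ θj′≡1 ⟩
    1              ≡⟨ cong suc (sym (upperBelow-≤k z≤n)) ⟩
    bottomLabel 0  ∎
    where
    open ≡-Reasoning
    j′≤0 : j′ ≤ 0
    j′≤0 = row-reflects-≤ 0 j′<m (subst (_≤ θ 0 0) (sym θj′≡1) (proj₁ (label-bounds 0 0 0<m)))
  bottom≡bottomLabel (suc j) 1+j<m with step j | bottom≡bottomLabel j (<-trans (n<1+n j) 1+j<m)
  ... | flat {h} refl h′≡h notUpperLabel | θj≡ = begin
    θ 0 (suc j)      ≡⟨ bottom-squeeze 1+j<m θj<next (bottom-next≥ 1+j<m θj≡) (upperLabel≢⇒θ≢ notUpperLabel) ⟩
    2 + (j + h)      ≡⟨ cong (λ x → 2 + (j + x)) (sym h′≡h) ⟩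
    bottomLabel (suc j) ∎
    where
    open ≡-Reasoning
    θj<next : θ 0 j < 2 + (j + h)
    θj<next = ≤-reflexive (cong suc θj≡)
  ... | rise {h} refl h<n h′≡1+h label≡ notUpperLabel | θj≡ = begin
    θ 0 (suc j)      ≡⟨ bottom-squeeze 1+j<m (m≤n⇒m≤1+n (≤-reflexive (cong suc θj≡)))
                                       (≤∧≢⇒< (bottom-next≥ 1+j<m θj≡) next≢θ)
                                       (upperLabel≢⇒θ≢ λ c _ → notUpperLabel c) ⟩
    3 + (j + h)      ≡⟨ cong (2 +_) (sym (+-suc j h)) ⟩
    2 + (j + suc h)  ≡⟨ cong (λ x → 2 + (j + x)) (sym h′≡1+h) ⟩
    bottomLabel (suc j) ∎
    where
    open ≡-Reasoning
    next≢θ : 2 + (j + h) ≢ θ 0 (suc j)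
    next≢θ eq = 0≢1+n (cong proj₁ (label-injective 0 (suc j) 1 h 1+j<m h<n
                                      (trans (sym eq) (trans label≡ (sym (upper h h<n))))))

  upper<bottom : ∀ {j c} → j < m → c < upperBelow j → θ 1 c < θ 0 j
  upper<bottom {j} {c} j<m c<h =
    subst₂ _<_ (sym (upper c (<-≤-trans c<h (upperBelow≤n j)))) (sym (bottom≡bottomLabel j j<m))
               (upperLabel<bottomLabel c<h)

  bottom<upper : ∀ {j c} → j < m → c < n → upperBelow j ≤ c → θ 0 j < θ 1 c
  bottom<upper {j} {c} j<m c<n h≤c =
    subst₂ _<_ (sym (bottom≡bottomLabel j j<m)) (sym (upper c c<n)) (bottomLabel<upperLabel h≤c c<n)

  upperBelow-m : upperBelow m ≡ n
  upperBelow-m = m≤n⇒m⊓n≡m (m+n≤o⇒m≤o∸n n (subst (_≤ m) (+-comm k n) k+n≤m))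

  deficit⇒∈ : ∀ {p q x} → Subpartition (p , q) (m , n) →
              IsDeficitCell (m , n) θ (p , q) x → x ∈ deficitCells (p , q)
  deficit⇒∈ _ ((0 , j₁) , (0 , j₂) , j₁<p , j₂<m , j₂≮p , θ<θ , refl) =
    contradiction θ<θ (<-asym (row-strictMono 0 (<-≤-trans j₁<p (≮⇒≥ j₂≮p)) j₂<m))
  deficit⇒∈ _ ((1 , j₁) , (1 , j₂) , j₁<q , j₂<n , j₂≮q , θ<θ , refl) =
    contradiction θ<θ (<-asym (row-strictMono 1 (<-≤-trans j₁<q (≮⇒≥ j₂≮q)) j₂<n))
  deficit⇒∈ {p} {q} (q≤p , _) ((1 , j₁) , (0 , j₂) , j₁<q , j₂<m , j₂≮p , θ<θ , refl) =
    subst (λ c → (0 , c) ∈ deficitCells (p , q)) (sym (m≤n⇒m⊓n≡m (<⇒≤ (<-≤-trans j₁<q (≤-trans q≤p p≤j₂)))))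
      (∈-deficitCells⁺ (p , q) (≤-trans (m⊓n≤n q _) (≤-trans (upperBelow-mono p≤j₂) h≤j₁))
                               (<-≤-trans j₁<q (m≤m⊔n q _)))
    where
    p≤j₂ : p ≤ j₂
    p≤j₂ = ≮⇒≥ j₂≮p
    h≤j₁ : upperBelow j₂ ≤ j₁
    h≤j₁ = ≮⇒≥ λ j₁<h → <-asym θ<θ (upper<bottom j₂<m j₁<h)
  deficit⇒∈ {p} {q} (_ , p≤m , _) ((0 , j₁) , (1 , j₂) , j₁<p , j₂<n , j₂≮q , θ<θ , refl) =
    subst (λ c → (0 , c) ∈ deficitCells (p , q)) (sym (m≥n⇒m⊓n≡n (≤-trans (<⇒≤ j₂<h) (upperBelow≤id j₁))))
      (∈-deficitCells⁺ (p , q) (≤-trans (m⊓n≤m q _) (≮⇒≥ j₂≮q))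
                               (<-≤-trans j₂<h (≤-trans (upperBelow-mono (<⇒≤pred j₁<p)) (m≤n⊔m q _))))
    where
    j₂<h : j₂ < upperBelow j₁
    j₂<h = ≰⇒> λ h≤j₂ → <-asym θ<θ (bottom<upper (<-≤-trans j₁<p p≤m) j₂<n h≤j₂)
  deficit⇒∈ _ ((suc (suc _) , _) , _ , () , _)
  deficit⇒∈ _ ((0 , _) , (suc (suc _) , _) , _ , () , _)
  deficit⇒∈ _ ((1 , _) , (suc (suc _) , _) , _ , () , _)

  deficit-below-q : ∀ {p q c} → Subpartition (p , q) (m , n) → c < q → deficitStart (p , q) ≤ c →
                    IsDeficitCell (m , n) θ (p , q) (0 , c)
  deficit-below-q {p} {q} {c} (q≤p , p≤m , q≤n) c<q start≤c =
    (1 , c) , (0 , p) , c<q , p<m , <-irrefl refl , bottom<upper p<m c<n h≤c ,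
    cong (0 ,_) (sym (m≤n⇒m⊓n≡m (<⇒≤ (<-≤-trans c<q q≤p))))
    where
    c<n : c < n
    c<n = <-≤-trans c<q q≤n
    h≤c : upperBelow p ≤ c
    h≤c = m⊓n≤o∧o<m⇒n≤o start≤c c<q
    p<m : p < m
    p<m = ≤∧≢⇒< p≤m λ { refl → <⇒≱ c<n (subst (_≤ c) upperBelow-m h≤c) }

  deficit-from-q : ∀ {p q c} → Subpartition (p , q) (m , n) → q ≤ c → c < deficitEnd (p , q) →
                   IsDeficitCell (m , n) θ (p , q) (0 , c)
  deficit-from-q {zero} {q} {c} _ q≤c c<end =
    contradiction (subst (c <_) (upperBelow-≤k z≤n) (o<m⊔n∧m≤o⇒o<n c<end q≤c)) λ ()
  deficit-from-q {suc p} {q} {c} (_ , 1+p≤m , _) q≤c c<end =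
    (0 , p) , (1 , c) , n<1+n p , c<n , ≤⇒≯ q≤c , upper<bottom 1+p≤m c<h ,
    cong (0 ,_) (sym (m≥n⇒m⊓n≡n (≤-trans (<⇒≤ c<h) (upperBelow≤id p))))
    where
    c<h : c < upperBelow p
    c<h = o<m⊔n∧m≤o⇒o<n c<end q≤c
    c<n : c < n
    c<n = <-≤-trans c<h (upperBelow≤n p)

  ∈⇒deficit : ∀ {p q x} → Subpartition (p , q) (m , n) →
              x ∈ deficitCells (p , q) → IsDeficitCell (m , n) θ (p , q) x
  ∈⇒deficit {p} {q} sub x∈ with ∈-deficitCells⁻ (p , q) x∈
  ... | c , refl , start≤c , c<end with c <? q
  ...   | yes c<q = deficit-below-q sub c<q start≤c
  ...   | no c≮q  = deficit-from-q sub (≮⇒≥ c≮q) c<end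

  hasDef-defect : ∀ {μ} → Subpartition μ (m , n) → HasDef (m , n) θ μ (defect μ)
  hasDef-defect {p , q} sub =
    deficitCells (p , q) , rowInterval-unique _ _ ,
    (λ x → mk⇔ (∈⇒deficit sub) (deficit⇒∈ sub)) , length-applyUpTo _ _

-- k = n + i - 2 turns the upper labels n + i + 2c into upperLabel k c; for n = 0 any k will do.
rowRegular-offset : ∀ {m n θ} → RowRegular m n θ →
  Σ ℕ λ k → n ≤ suc k × k + n ≤ m × SYT m n θ × (∀ c → c < n → θ 1 c ≡ upperLabel k c)
rowRegular-offset {n = zero} (_ , _ , _ , syt , _) = 0 , z≤n , z≤n , syt , λ _ ()
rowRegular-offset {n = suc n} (zero , () , _)
rowRegular-offset {m} {suc n} (suc i , _ , i+2n≤m+2 , syt , upper) =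
  n + i , s≤s (m≤m+n n i) , ≤-pred (≤-pred (subst₂ _≤_ shift (+-comm m 2) i+2n≤m+2)) , syt ,
  λ c c<n → trans (upper c c<n) (label≡ c)
  where
  shift : suc i + 2 * suc n ≡ 2 + (n + i + suc n)
  shift = solve (n ∷ i ∷ [])
  label≡ : ∀ c → suc n + suc i + 2 * c ≡ 2 + (n + i) + (c + c)
  label≡ c = solve (n ∷ i ∷ c ∷ [])

proposition4p13 : (m n : ℕ) → n ≤ m → Triangular m n →
    (θ : ℕ → ℕ → ℕ) → RowRegular m n θ →
    ((d a : ℕ) → d ≤ min n (m ∸ n) → d ≤ a → a + 2 * d ≤ m + n →
       Σ (ℕ × ℕ) λ μ →
         (Subpartition μ (m , n) × HasDef (m , n) θ μ d × area (m , n) μ ≡ a)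
         × ((μ′ : ℕ × ℕ) → Subpartition μ′ (m , n) → HasDef (m , n) θ μ′ d →
              area (m , n) μ′ ≡ a → μ′ ≡ μ))
    × ((μ : ℕ × ℕ) → Subpartition μ (m , n) →
         Σ ℕ λ d → Σ ℕ λ a →
           d ≤ min n (m ∸ n) × d ≤ a × a + 2 * d ≤ m + n
           × HasDef (m , n) θ μ d × area (m , n) μ ≡ a)
proposition4p13 m n _ _ θ rowRegular with rowRegular-offset rowRegular
... | k , n≤1+k , k+n≤m , syt , upper =
  (λ d a d≤min d≤a a+2d≤m+n →
    let μ , sub , defect≡d , area≡a = admissible-preimage d≤min d≤a a+2d≤m+n in
    μ , (sub , subst (HasDef (m , n) θ μ) defect≡d (hasDef-defect sub) , area≡a) ,
    λ μ′ sub′ hasDef′ area′≡a →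
      defect-area-injective sub′ sub
        (trans (HasDef-functional (hasDef-defect sub′) hasDef′) (sym defect≡d))
        (trans area′≡a (sym area≡a))) ,
  λ μ sub →
    let d≤min , d≤a , a+2d≤m+n = subpartition-admissible sub in
    defect μ , area (m , n) μ , d≤min , d≤a , a+2d≤m+n , hasDef-defect sub , refl
  where
  open Deficit k n
  open Classification k n m n≤1+k k+n≤m
  open RowRegularTableau syt upper k+n≤m
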